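{- For a transitive tournament $T$ of order $n$, we have $\gamma_L(T)=\lceil\frac{n}{2}\rceil$ and the location number of $T$ equals $\lfloor\frac{n}{2}\rfloor$.
   Context: A tournament has a unique arc between any pair of vertices; it is transitive if it is acyclic. A set $S$ of vertices is locating if every vertex not in $S$ has a distinct set of in-neighbours in $S$; the location number is the minimum size of a locating set. A set is dominating if every vertex outside it has an in-neighbour in it, and locating-dominating if it is both locating and dominating; $\gamma_L(T)$ is the minimum size of a locating-dominating set. -}

module Defs where

open import Data.Nat using (ℕ; _≤_; _/_; suc; _+_)
open import Data.Bool using (Bool; true; false)
open import Data.Fin using (Fin)
open import Data.Fin.Subset using (Subset; _∈_; _∉_; ∣_∣)
open import Data.Product using (Σ; ∃; _×_; _,_)
open import Relation.Binary.PropositionalEquality using (_≡_; _≢_)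
open import Relation.Nullary using (¬_)
open import Relation.Binary.Construct.Closure.Transitive using (TransClosure)
open import Data.Sum using (_⊎_)
open import Function.Bundles using (_⇔_)

record Tournament (n : ℕ) : Set where
  field
    adj : Fin n → Fin n → Bool
    irrefl : ∀ u → adj u u ≡ false
    tourn : ∀ u v → u ≢ v → (adj u v ≡ true × adj v u ≡ false)
                             ⊎ (adj u v ≡ false × adj v u ≡ true)

module _ {n : ℕ} (T : Tournament n) where
  open Tournament T

  Arc : Fin n → Fin n → Set
  Arc u v = adj u v ≡ true

  -- transitive tournament = acyclic: no directed cycle, i.e. no vertex
  -- reaches itself by a nonempty directed path
  IsTransitive : Set
  IsTransitive = ∀ u → ¬ TransClosure Arc u u

  IsLocating : Subset n → Set
  IsLocating S = ∀ u v → u ∉ S → v ∉ S → u ≢ v →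
    ¬ (∀ w → w ∈ S → (Arc w u ⇔ Arc w v))

  IsDominating : Subset n → Set
  IsDominating S = ∀ u → u ∉ S → ∃ λ w → w ∈ S × Arc w u

  IsLocDom : Subset n → Set
  IsLocDom S = IsLocating S × IsDominating S

IsMinSize : {n : ℕ} → (Subset n → Set) → ℕ → Set
IsMinSize {n} P k = (∃ λ S → P S × ∣ S ∣ ≡ k) × (∀ S → P S → k ≤ ∣ S ∣)

LocationNumberIs : {n : ℕ} → Tournament n → ℕ → Set
LocationNumberIs T k = IsMinSize (IsLocating T) k

γL-Is : {n : ℕ} → Tournament n → ℕ → Set
γL-Is T k = IsMinSize (IsLocDom T) k

⌈_/2⌉ : ℕ → ℕ
⌈ n /2⌉ = suc n / 2

⌊_/2⌋ : ℕ → ℕ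
⌊ n /2⌋ = n / 2

-- In a transitive tournament the in-degree ("rank") is a bijection onto
-- {0, …, n-1} and u → v iff rank u < rank v, so a vertex w separates two
-- vertices u, v exactly when rank u ≤ rank w < rank v.  Hence S is locating
-- iff no two vertices of consecutive rank both lie outside S.  Sending each
-- outsider to the vertex of the preceding rank then injects ∁ S into S
-- together with one extra point (needed only for rank 0, which a dominating
-- set must contain), so n ≤ 2∣S∣ + 1, resp. n ≤ 2∣S∣.  The vertices of odd
-- rank, resp. of even rank, attain these bounds.
module Submission where

open import Defs
open import Data.Nat using (ℕ)
open import Data.Product using (_×_)

import Data.Nat as Nat
open import Data.Nat using (zero; suc; _+_; _∸_; _≤_; _<_; z≤n; s≤s)
open import Data.Nat.Properties
open import Data.Nat.DivMod using (_/_; m/n≡1+[m∸n]/n)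
open import Data.Bool using (Bool; true; false; not)
open import Data.Bool.Properties using (not-¬; not-involutive)
open import Data.Fin using (Fin; zero; suc; toℕ; fromℕ<; punchOut)
open import Data.Fin.Properties
  using (toℕ-injective; toℕ-fromℕ<; toℕ<n; any?; injective⇒≤; punchOut-injective)
  renaming (_≟_ to _≟ᶠ_; suc-injective to Fin-suc-injective)
open import Data.Fin.Subset using (Subset; _∈_; _∉_; ∣_∣; ⊤; ∁; _-_)
open import Data.Fin.Subset.Properties
  using ( _∈?_; ∈⊤; ∣⊤∣≡n; ∣∁p∣≡n∸∣p∣; ∣p∣≤n; p⊂q⇒∣p∣<∣q∣; x∈p⇒∣p-x∣<∣p∣
        ; x∈p∧x≢y⇒x∈p-y; x∉p⇒x∈∁p; x∈∁p⇒x∉p; x∉∁p⇒x∈p)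
open import Data.Vec using ([]; _∷_; tabulate; here; there)
open import Data.Vec.Properties using (lookup∘tabulate; []=⇒lookup; lookup⇒[]=)
open import Data.Product using (∃; _,_; proj₁; proj₂)
open import Data.Sum using (_⊎_; inj₁; inj₂)
open import Data.Empty using (⊥-elim)
open import Function using (_∘_)
open import Function.Bundles using (mk⇔; Equivalence)
open import Function.Definitions using (Injective)
open import Relation.Binary.Definitions using (tri<; tri≈; tri>)
open import Relation.Binary.PropositionalEquality
open import Relation.Binary.Construct.Closure.Transitive using ([_]; _∷_)
open import Relation.Nullary using (¬_; yes; no; contradiction)
open import Relation.Nullary.Decidable using (decidable-stable)

∈-tabulate⁺ : ∀ {n} {g : Fin n → Bool} {x} → g x ≡ true → x ∈ tabulate g
∈-tabulate⁺ {g = g} {x} gx = lookup⇒[]= x (tabulate g) (trans (lookup∘tabulate g x) gx)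

∈-tabulate⁻ : ∀ {n} {g : Fin n → Bool} {x} → x ∈ tabulate g → g x ≡ true
∈-tabulate⁻ {g = g} {x} x∈ = trans (sym (lookup∘tabulate g x)) ([]=⇒lookup x∈)

injective⇒∣p∣≤∣q∣ : ∀ {m k} {p : Subset m} {q : Subset k} (f : Fin m → Fin k) →
  Injective _≡_ _≡_ f → (∀ {x} → x ∈ p → f x ∈ q) → ∣ p ∣ ≤ ∣ q ∣
injective⇒∣p∣≤∣q∣ {p = []} f _ _ = z≤n
injective⇒∣p∣≤∣q∣ {p = false ∷ p} f f-inj f∈ =
  injective⇒∣p∣≤∣q∣ {p = p} (f ∘ suc) (Fin-suc-injective ∘ f-inj) (f∈ ∘ there)
injective⇒∣p∣≤∣q∣ {p = true ∷ p} {q} f f-inj f∈ = ≤-<-trans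
  (injective⇒∣p∣≤∣q∣ {p = p} {q - f zero} (f ∘ suc) (Fin-suc-injective ∘ f-inj)
    (λ x∈p → x∈p∧x≢y⇒x∈p-y (f∈ (there x∈p)) ((λ ()) ∘ f-inj)))
  (x∈p⇒∣p-x∣<∣p∣ (f∈ here))

∣p∣+∣∁p∣≡n : ∀ {n} (p : Subset n) → ∣ p ∣ + ∣ ∁ p ∣ ≡ n
∣p∣+∣∁p∣≡n p = trans (cong (∣ p ∣ +_) (∣∁p∣≡n∸∣p∣ p)) (m+[n∸m]≡n (∣p∣≤n p))

∣p∣≡m : ∀ {n m k} (p : Subset n) → m ≤ ∣ p ∣ → k ≤ ∣ ∁ p ∣ → m + k ≡ n → ∣ p ∣ ≡ m
∣p∣≡m {n} {m} {k} p m≤∣p∣ k≤∣∁p∣ m+k≡n = ≤-antisym (+-cancelʳ-≤ k ∣ p ∣ m ∣p∣+k≤m+k) m≤∣p∣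
  where
  ∣p∣+k≤m+k : ∣ p ∣ + k ≤ m + k
  ∣p∣+k≤m+k = begin
    ∣ p ∣ + k       ≤⟨ +-monoʳ-≤ ∣ p ∣ k≤∣∁p∣ ⟩
    ∣ p ∣ + ∣ ∁ p ∣ ≡⟨ ∣p∣+∣∁p∣≡n p ⟩
    n               ≡⟨ sym m+k≡n ⟩
    m + k           ∎
    where open ≤-Reasoning

injective⇒m≤∣q∣ : ∀ {m k} {q : Subset k} (f : Fin m → Fin k) →
  Injective _≡_ _≡_ f → (∀ x → f x ∈ q) → m ≤ ∣ q ∣
injective⇒m≤∣q∣ {m} f f-inj f∈ =
  subst (_≤ _) (∣⊤∣≡n m) (injective⇒∣p∣≤∣q∣ {p = ⊤} f f-inj (λ {x} _ → f∈ x))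

injective⇒surjective : ∀ {n} {f : Fin n → Fin n} → Injective _≡_ _≡_ f →
  ∀ y → ∃ λ x → f x ≡ y
injective⇒surjective {suc n} {f} f-inj y with any? (λ x → f x ≟ᶠ y)
... | yes found = found
... | no  missed = contradiction (injective⇒≤ f-punchOut-injective) 1+n≰n
  where
  y≢f : ∀ x → y ≢ f x
  y≢f x y≡fx = missed (x , sym y≡fx)
  f-punchOut-injective : Injective _≡_ _≡_ (λ x → punchOut (y≢f x))
  f-punchOut-injective = f-inj ∘ punchOut-injective (y≢f _) (y≢f _)

n/2≡⌊n/2⌋ : ∀ n → n / 2 ≡ Nat.⌊ n /2⌋
n/2≡⌊n/2⌋ zero = refl
n/2≡⌊n/2⌋ (suc zero) = refl
n/2≡⌊n/2⌋ (suc (suc n)) = trans (m/n≡1+[m∸n]/n {suc (suc n)} {2} (s≤s (s≤s z≤n))) (cong suc (n/2≡⌊n/2⌋ n))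

n≤1+2s⇒⌊n/2⌋≤s : ∀ {n} s → n ≤ suc (s + s) → Nat.⌊ n /2⌋ ≤ s
n≤1+2s⇒⌊n/2⌋≤s s n≤ = subst (_ ≤_) (sym (n≡⌈n+n/2⌉ s)) (⌊n/2⌋-mono n≤)

n≤2s⇒⌈n/2⌉≤s : ∀ {n} s → n ≤ s + s → Nat.⌈ n /2⌉ ≤ s
n≤2s⇒⌈n/2⌉≤s s n≤ = subst (_ ≤_) (sym (n≡⌈n+n/2⌉ s)) (⌈n/2⌉-mono n≤)

i<⌊n/2⌋⇒1+2i<n : ∀ {n i} → i < Nat.⌊ n /2⌋ → suc (i + i) < n
i<⌊n/2⌋⇒1+2i<n {i = i} i< = ≰⇒> (<⇒≱ i< ∘ n≤1+2s⇒⌊n/2⌋≤s i)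

i<⌈n/2⌉⇒2i<n : ∀ {n i} → i < Nat.⌈ n /2⌉ → i + i < n
i<⌈n/2⌉⇒2i<n {i = i} i< = ≰⇒> (<⇒≱ i< ∘ n≤2s⇒⌈n/2⌉≤s i)

double-injective : ∀ {i j} → i + i ≡ j + j → i ≡ j
double-injective {i} {j} 2i≡2j = begin
  i              ≡⟨ n≡⌊n+n/2⌋ i ⟩
  Nat.⌊ i + i /2⌋ ≡⟨ cong Nat.⌊_/2⌋ 2i≡2j ⟩
  Nat.⌊ j + j /2⌋ ≡⟨ sym (n≡⌊n+n/2⌋ j) ⟩
  j              ∎
  where open ≡-Reasoning

isOdd : ℕ → Bool
isOdd zero = false
isOdd (suc n) = not (isOdd n)

isOdd-double : ∀ i → isOdd (i + i) ≡ false
isOdd-double zero = refl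
isOdd-double (suc i) rewrite +-suc i i = trans (not-involutive _) (isOdd-double i)

module TransitiveTournament {n : ℕ} (T : Tournament n) (acyclic : IsTransitive T) where
  open Tournament T

  private variable
    u v : Fin n
    S : Subset n

  irreflexive : ¬ Arc T u u
  irreflexive {u} uu with trans (sym (irrefl u)) uu
  ... | ()

  connex : u ≢ v → Arc T u v ⊎ Arc T v u
  connex {u} {v} u≢v with tourn u v u≢v
  ... | inj₁ (uv , _) = inj₁ uv
  ... | inj₂ (_ , vu) = inj₂ vu

  arc-trans : ∀ {w} → Arc T u v → Arc T v w → Arc T u w
  arc-trans {u} {v} {w} uv vw with u ≟ᶠ w
  ... | yes refl = ⊥-elim (acyclic u (uv ∷ [ vw ]))
  ... | no u≢w with connex u≢w
  ...   | inj₁ uw = uw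
  ...   | inj₂ wu = ⊥-elim (acyclic u (uv ∷ vw ∷ [ wu ]))

  inNeighbours : Fin n → Subset n
  inNeighbours v = tabulate (λ w → adj w v)

  rank : Fin n → ℕ
  rank v = ∣ inNeighbours v ∣

  arc⇒rank< : Arc T u v → rank u < rank v
  arc⇒rank< {u} uv = p⊂q⇒∣p∣<∣q∣
    ( (λ wu → ∈-tabulate⁺ (arc-trans (∈-tabulate⁻ wu) uv))
    , u , ∈-tabulate⁺ uv , irreflexive ∘ ∈-tabulate⁻)

  rank<n : ∀ v → rank v < n
  rank<n v = subst (rank v <_) (∣⊤∣≡n n)
    (p⊂q⇒∣p∣<∣q∣ ((λ _ → ∈⊤) , v , ∈⊤ , irreflexive ∘ ∈-tabulate⁻))

  rank<⇒arc : rank u < rank v → Arc T u v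
  rank<⇒arc {u} {v} r< with u ≟ᶠ v
  ... | yes refl = contradiction r< (<-irrefl refl)
  ... | no u≢v with connex u≢v
  ...   | inj₁ uv = uv
  ...   | inj₂ vu = contradiction (arc⇒rank< vu) (<-asym r<)

  rank-injective : Injective _≡_ _≡_ rank
  rank-injective {u} {v} r≡ with u ≟ᶠ v
  ... | yes u≡v = u≡v
  ... | no u≢v with connex u≢v
  ...   | inj₁ uv = contradiction r≡ (<⇒≢ (arc⇒rank< uv))
  ...   | inj₂ vu = contradiction (sym r≡) (<⇒≢ (arc⇒rank< vu))

  rank-surjective : ∀ k → k < n → ∃ λ v → rank v ≡ k
  rank-surjective k k<n = x , (begin
    rank x           ≡⟨ toℕ-rankᶠ x ⟨
    toℕ (rankᶠ x)    ≡⟨ cong toℕ rankᶠx≡k ⟩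
    toℕ (fromℕ< k<n) ≡⟨ toℕ-fromℕ< k<n ⟩
    k                ∎)
    where
    open ≡-Reasoning
    rankᶠ : Fin n → Fin n
    rankᶠ v = fromℕ< (rank<n v)
    toℕ-rankᶠ : ∀ v → toℕ (rankᶠ v) ≡ rank v
    toℕ-rankᶠ v = toℕ-fromℕ< (rank<n v)
    rankᶠ-injective : Injective _≡_ _≡_ rankᶠ
    rankᶠ-injective {u} {v} eq =
      rank-injective (trans (sym (toℕ-rankᶠ u)) (trans (cong toℕ eq) (toℕ-rankᶠ v)))
    x : Fin n
    x = proj₁ (injective⇒surjective rankᶠ-injective (fromℕ< k<n))
    rankᶠx≡k : rankᶠ x ≡ fromℕ< k<n
    rankᶠx≡k = proj₂ (injective⇒surjective rankᶠ-injective (fromℕ< k<n))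

  vertexOfRank : ∀ k → k < n → Fin n
  vertexOfRank k k<n = proj₁ (rank-surjective k k<n)

  rank-vertexOfRank : ∀ k (k<n : k < n) → rank (vertexOfRank k k<n) ≡ k
  rank-vertexOfRank k k<n = proj₂ (rank-surjective k k<n)

  vertexOfRank-injective : ∀ {j k} (j<n : j < n) (k<n : k < n) →
    vertexOfRank j j<n ≡ vertexOfRank k k<n → j ≡ k
  vertexOfRank-injective {j} {k} j<n k<n eq =
    trans (sym (rank-vertexOfRank j j<n)) (trans (cong rank eq) (rank-vertexOfRank k k<n))

  NoConsecutiveOutsiders : Subset n → Set
  NoConsecutiveOutsiders S = ∀ {u v} → u ∉ S → v ∉ S → rank v ≢ suc (rank u)

  locating⇒noConsecutiveOutsiders : IsLocating T S → NoConsecutiveOutsiders S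
  locating⇒noConsecutiveOutsiders {S} locating {u} {v} u∉S v∉S rv≡1+ru =
    locating u v u∉S v∉S u≢v λ w w∈S → mk⇔ (λ wu → arc-trans wu uv) (wv⇒wu w∈S)
    where
    ru<rv : rank u < rank v
    ru<rv = subst (rank u <_) (sym rv≡1+ru) ≤-refl
    uv : Arc T u v
    uv = rank<⇒arc ru<rv
    u≢v : u ≢ v
    u≢v u≡v = <⇒≢ ru<rv (cong rank u≡v)
    wv⇒wu : ∀ {w} → w ∈ S → Arc T w v → Arc T w u
    wv⇒wu {w} w∈S wv with m<1+n⇒m<n∨m≡n (subst (rank w <_) rv≡1+ru (arc⇒rank< wv))
    ... | inj₁ rw<ru = rank<⇒arc rw<ru
    ... | inj₂ rw≡ru = contradiction (subst (_∈ S) (rank-injective rw≡ru) w∈S) u∉S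

  vertexOfNextRank∈ : NoConsecutiveOutsiders S → u ∉ S → (1+ru<n : suc (rank u) < n) →
    vertexOfRank (suc (rank u)) 1+ru<n ∈ S
  vertexOfNextRank∈ {S} noConsecutive u∉S 1+ru<n = decidable-stable (_ ∈? S) λ w∉S →
    noConsecutive u∉S w∉S (rank-vertexOfRank _ 1+ru<n)

  noConsecutiveOutsiders⇒separated : NoConsecutiveOutsiders S → u ∉ S → v ∉ S →
    rank u < rank v → ∃ λ w → w ∈ S × Arc T w v × ¬ Arc T w u
  noConsecutiveOutsiders⇒separated {S} {u} {v} noConsecutive u∉S v∉S ru<rv =
    w , w∈S , rank<⇒arc rw<rv , <-asym ru<rw ∘ arc⇒rank<
    where
    1+ru<n : suc (rank u) < n
    1+ru<n = ≤-<-trans ru<rv (rank<n v)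
    w : Fin n
    w = vertexOfRank (suc (rank u)) 1+ru<n
    w∈S : w ∈ S
    w∈S = vertexOfNextRank∈ noConsecutive u∉S 1+ru<n
    rw≡1+ru : rank w ≡ suc (rank u)
    rw≡1+ru = rank-vertexOfRank _ 1+ru<n
    ru<rw : rank u < rank w
    ru<rw = subst (rank u <_) (sym rw≡1+ru) ≤-refl
    rw<rv : rank w < rank v
    rw<rv = ≤∧≢⇒< (subst (_≤ rank v) (sym rw≡1+ru) ru<rv)
                   λ rw≡rv → v∉S (subst (_∈ S) (rank-injective rw≡rv) w∈S)

  noConsecutiveOutsiders⇒locating : NoConsecutiveOutsiders S → IsLocating T S
  noConsecutiveOutsiders⇒locating noConsecutive u v u∉S v∉S u≢v sameIn
    with <-cmp (rank u) (rank v)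
  ... | tri≈ _ ru≡rv _ = u≢v (rank-injective ru≡rv)
  ... | tri< ru<rv _ _ =
    let w , w∈S , wv , ¬wu = noConsecutiveOutsiders⇒separated noConsecutive u∉S v∉S ru<rv
    in ¬wu (Equivalence.from (sameIn w w∈S) wv)
  ... | tri> _ _ rv<ru =
    let w , w∈S , wu , ¬wv = noConsecutiveOutsiders⇒separated noConsecutive v∉S u∉S rv<ru
    in ¬wv (Equivalence.to (sameIn w w∈S) wu)

  dominating⇒rank≢0 : IsDominating T S → u ∉ S → rank u ≢ 0
  dominating⇒rank≢0 dominating u∉S ru≡0 =
    let w , _ , wu = dominating _ u∉S in n≮0 (subst (rank w <_) ru≡0 (arc⇒rank< wu))

  -- zero stands for "no predecessor", the image of the vertex of rank 0.
  previous : ∀ k → k < n → Fin (suc n)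
  previous zero    _     = zero
  previous (suc k) 1+k<n = suc (vertexOfRank k (<⇒≤ 1+k<n))

  previous-injective : ∀ {j k} {j<n : j < n} {k<n : k < n} →
    previous j j<n ≡ previous k k<n → j ≡ k
  previous-injective {zero}  {zero}  _  = refl
  previous-injective {suc j} {suc k} {j<n} {k<n} eq = cong suc
    (vertexOfRank-injective (<⇒≤ j<n) (<⇒≤ k<n) (Fin-suc-injective eq))

  predecessor : Fin n → Fin (suc n)
  predecessor u = previous (rank u) (rank<n u)

  predecessor-injective : Injective _≡_ _≡_ predecessor
  predecessor-injective {u} {v} eq =
    rank-injective (previous-injective {j<n = rank<n u} {k<n = rank<n v} eq)

  predecessor∈ : ∀ {b} → NoConsecutiveOutsiders S → u ∉ S → (rank u ≡ 0 → b ≡ true) →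
    predecessor u ∈ b ∷ S
  predecessor∈ {S} {u} {b} noConsecutive u∉S rank0⇒b = previous∈ (rank u) (rank<n u) refl
    where
    previous∈ : ∀ k (k<n : k < n) → rank u ≡ k → previous k k<n ∈ b ∷ S
    previous∈ zero    _     ru≡0 rewrite rank0⇒b ru≡0 = here
    previous∈ (suc k) 1+k<n ru≡1+k = there (decidable-stable (_ ∈? S) λ w∉S →
      noConsecutive w∉S u∉S (trans ru≡1+k (cong suc (sym (rank-vertexOfRank k (<⇒≤ 1+k<n))))))

  ⌊n/2⌋≤∣locating∣ : IsLocating T S → Nat.⌊ n /2⌋ ≤ ∣ S ∣
  ⌊n/2⌋≤∣locating∣ {S} locating = n≤1+2s⇒⌊n/2⌋≤s ∣ S ∣ (begin
    n                   ≡⟨ ∣p∣+∣∁p∣≡n S ⟨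
    ∣ S ∣ + ∣ ∁ S ∣     ≤⟨ +-monoʳ-≤ ∣ S ∣ ∣∁S∣≤1+∣S∣ ⟩
    ∣ S ∣ + suc ∣ S ∣   ≡⟨ +-suc ∣ S ∣ ∣ S ∣ ⟩
    suc (∣ S ∣ + ∣ S ∣) ∎)
    where
    open ≤-Reasoning
    ∣∁S∣≤1+∣S∣ : ∣ ∁ S ∣ ≤ ∣ true ∷ S ∣
    ∣∁S∣≤1+∣S∣ = injective⇒∣p∣≤∣q∣ predecessor predecessor-injective λ u∈∁S →
      predecessor∈ (locating⇒noConsecutiveOutsiders locating) (x∈∁p⇒x∉p u∈∁S) (λ _ → refl)

  ⌈n/2⌉≤∣locDom∣ : IsLocDom T S → Nat.⌈ n /2⌉ ≤ ∣ S ∣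
  ⌈n/2⌉≤∣locDom∣ {S} (locating , dominating) = n≤2s⇒⌈n/2⌉≤s ∣ S ∣ (begin
    n                   ≡⟨ ∣p∣+∣∁p∣≡n S ⟨
    ∣ S ∣ + ∣ ∁ S ∣     ≤⟨ +-monoʳ-≤ ∣ S ∣ ∣∁S∣≤∣S∣ ⟩
    ∣ S ∣ + ∣ S ∣       ∎)
    where
    open ≤-Reasoning
    ∣∁S∣≤∣S∣ : ∣ ∁ S ∣ ≤ ∣ false ∷ S ∣
    ∣∁S∣≤∣S∣ = injective⇒∣p∣≤∣q∣ predecessor predecessor-injective λ u∈∁S →
      let u∉S = x∈∁p⇒x∉p u∈∁S in
      predecessor∈ {b = false} (locating⇒noConsecutiveOutsiders locating) u∉S
        (⊥-elim ∘ dominating⇒rank≢0 dominating u∉S)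

  oddRanked : Subset n
  oddRanked = tabulate (isOdd ∘ rank)

  ∉oddRanked⇒isOdd≡false : u ∉ oddRanked → isOdd (rank u) ≡ false
  ∉oddRanked⇒isOdd≡false {u} u∉ with isOdd (rank u) in odd
  ... | true  = contradiction (∈-tabulate⁺ odd) u∉
  ... | false = refl

  ∉∁oddRanked⇒isOdd≡true : u ∉ ∁ oddRanked → isOdd (rank u) ≡ true
  ∉∁oddRanked⇒isOdd≡true = ∈-tabulate⁻ ∘ x∉∁p⇒x∈p

  isOdd≡false⇒∈∁oddRanked : isOdd (rank u) ≡ false → u ∈ ∁ oddRanked
  isOdd≡false⇒∈∁oddRanked even = x∉p⇒x∈∁p λ u∈ →
    contradiction (trans (sym even) (∈-tabulate⁻ u∈)) λ ()

  outsidersOfEqualParity⇒noConsecutiveOutsiders :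
    (∀ {u v} → u ∉ S → v ∉ S → isOdd (rank u) ≡ isOdd (rank v)) → NoConsecutiveOutsiders S
  outsidersOfEqualParity⇒noConsecutiveOutsiders equalParity u∉S v∉S rv≡1+ru =
    not-¬ refl (trans (equalParity u∉S v∉S) (cong isOdd rv≡1+ru))

  oddRanked-locating : IsLocating T oddRanked
  oddRanked-locating = noConsecutiveOutsiders⇒locating
    (outsidersOfEqualParity⇒noConsecutiveOutsiders λ u∉ v∉ →
      trans (∉oddRanked⇒isOdd≡false u∉) (sym (∉oddRanked⇒isOdd≡false v∉)))

  ∁oddRanked-locating : IsLocating T (∁ oddRanked)
  ∁oddRanked-locating = noConsecutiveOutsiders⇒locating
    (outsidersOfEqualParity⇒noConsecutiveOutsiders λ u∉ v∉ →
      trans (∉∁oddRanked⇒isOdd≡true u∉) (sym (∉∁oddRanked⇒isOdd≡true v∉)))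

  ∁oddRanked-dominating : IsDominating T (∁ oddRanked)
  ∁oddRanked-dominating u u∉ = dominator (rank u) refl (∉∁oddRanked⇒isOdd≡true u∉)
    where
    dominator : ∀ k → rank u ≡ k → isOdd k ≡ true → ∃ λ w → w ∈ ∁ oddRanked × Arc T w u
    dominator (suc k) ru≡1+k odd = w , isOdd≡false⇒∈∁oddRanked even , rank<⇒arc rw<ru
      where
      k<n : k < n
      k<n = <⇒≤ (subst (_< n) ru≡1+k (rank<n u))
      w : Fin n
      w = vertexOfRank k k<n
      even : isOdd (rank w) ≡ false
      even = trans (cong isOdd (rank-vertexOfRank k k<n))
                   (trans (sym (not-involutive (isOdd k))) (cong not odd))
      rw<ru : rank w < rank u
      rw<ru = subst₂ _<_ (sym (rank-vertexOfRank k k<n)) (sym ru≡1+k) ≤-refl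

  ∣oddRanked∣≡⌊n/2⌋ : ∣ oddRanked ∣ ≡ Nat.⌊ n /2⌋
  ∣oddRanked∣≡⌊n/2⌋ = ∣p∣≡m oddRanked
    (injective⇒m≤∣q∣ oddVertex oddVertex-injective λ i → ∈-tabulate⁺
      (trans (cong isOdd (rank-vertexOfRank _ (1+2i<n i))) (cong not (isOdd-double (toℕ i)))))
    (injective⇒m≤∣q∣ evenVertex evenVertex-injective λ i → isOdd≡false⇒∈∁oddRanked
      (trans (cong isOdd (rank-vertexOfRank _ (2i<n i))) (isOdd-double (toℕ i))))
    (⌊n/2⌋+⌈n/2⌉≡n n)
    where
    1+2i<n : (i : Fin Nat.⌊ n /2⌋) → suc (toℕ i + toℕ i) < n
    1+2i<n i = i<⌊n/2⌋⇒1+2i<n (toℕ<n i)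
    oddVertex : Fin Nat.⌊ n /2⌋ → Fin n
    oddVertex i = vertexOfRank _ (1+2i<n i)
    oddVertex-injective : Injective _≡_ _≡_ oddVertex
    oddVertex-injective {i} {j} = toℕ-injective ∘ double-injective ∘ suc-injective
      ∘ vertexOfRank-injective (1+2i<n i) (1+2i<n j)
    2i<n : (i : Fin Nat.⌈ n /2⌉) → toℕ i + toℕ i < n
    2i<n i = i<⌈n/2⌉⇒2i<n (toℕ<n i)
    evenVertex : Fin Nat.⌈ n /2⌉ → Fin n
    evenVertex i = vertexOfRank _ (2i<n i)
    evenVertex-injective : Injective _≡_ _≡_ evenVertex
    evenVertex-injective {i} {j} = toℕ-injective ∘ double-injective
      ∘ vertexOfRank-injective (2i<n i) (2i<n j)

  ∣∁oddRanked∣≡⌈n/2⌉ : ∣ ∁ oddRanked ∣ ≡ Nat.⌈ n /2⌉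
  ∣∁oddRanked∣≡⌈n/2⌉ = begin
    ∣ ∁ oddRanked ∣                                 ≡⟨ ∣∁p∣≡n∸∣p∣ oddRanked ⟩
    n ∸ ∣ oddRanked ∣                               ≡⟨ cong (n ∸_) ∣oddRanked∣≡⌊n/2⌋ ⟩
    n ∸ Nat.⌊ n /2⌋                                 ≡⟨ cong (_∸ Nat.⌊ n /2⌋) (⌊n/2⌋+⌈n/2⌉≡n n) ⟨
    Nat.⌊ n /2⌋ + Nat.⌈ n /2⌉ ∸ Nat.⌊ n /2⌋          ≡⟨ m+n∸m≡n Nat.⌊ n /2⌋ Nat.⌈ n /2⌉ ⟩
    Nat.⌈ n /2⌉                                     ∎
    where open ≡-Reasoning

proposition12 : (n : ℕ) (T : Tournament n) → IsTransitive T →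
    γL-Is T ⌈ n /2⌉ × LocationNumberIs T ⌊ n /2⌋
proposition12 n T acyclic =
  subst (γL-Is T) (sym (n/2≡⌊n/2⌋ (suc n)))
    ( (∁ oddRanked , (∁oddRanked-locating , ∁oddRanked-dominating) , ∣∁oddRanked∣≡⌈n/2⌉)
    , λ _ → ⌈n/2⌉≤∣locDom∣ )
  , subst (LocationNumberIs T) (sym (n/2≡⌊n/2⌋ n))
    ( (oddRanked , oddRanked-locating , ∣oddRanked∣≡⌊n/2⌋)
    , λ _ → ⌊n/2⌋≤∣locating∣ )
  where open TransitiveTournament T acyclic
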